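{- There is a constant $k>0$ such that for infinitely many primes $q$, every first-order sentence $\varphi$ in the language of rings $L(+,\times,0,1)$ describing the field $\mathbb F_q$ satisfies $\log q\le k\,|\varphi|\log|\varphi|$.
   Context: A sentence $\varphi$ describes a finite structure $M$ if $M\models\varphi$ and every model of $\varphi$ is isomorphic to $M$. $|\varphi|$ is the number of symbols of $\varphi$ as a string over an alphabet of finitely many logical symbols, infinitely many variables (each counted as one symbol), and the symbols of the language. Here $\log m=\min\{r\in\mathbb N:2^r\ge m\}$. -}

module Defs where

open import Level using (0ℓ)
open import Data.Nat using (ℕ; zero; suc; _+_; _*_; NonZero)
open import Data.Nat.DivMod using (_mod_)
open import Data.Nat.Primality using (Prime; prime⇒nonZero)
open import Data.Nat.Logarithm using (⌈log₂_⌉)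
open import Data.Fin using (Fin; toℕ)
open import Data.Product using (Σ; _×_; _,_)
open import Data.Empty using (⊥)
open import Relation.Nullary using (¬_)
open import Relation.Binary.PropositionalEquality using (_≡_; _≢_)
open import Function.Definitions using (Bijective)

Var : Set
Var = ℕ

data Term : Set where
  var  : Var → Term
  𝟘 𝟙  : Term
  _⊕_  : Term → Term → Term
  _⊗_  : Term → Term → Term

data Formula : Set where
  _≐_   : Term → Term → Formula
  ¬'_   : Formula → Formula
  _∧'_  : Formula → Formula → Formula
  _∨'_  : Formula → Formula → Formula
  _⇒'_  : Formula → Formula → Formula
  ∀'    : Var → Formula → Formula
  ∃'    : Var → Formula → Formula

data OccursT (x : Var) : Term → Set where
  here  : OccursT x (var x)
  ⊕ˡ    : ∀ {t s} → OccursT x t → OccursT x (t ⊕ s)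
  ⊕ʳ    : ∀ {t s} → OccursT x s → OccursT x (t ⊕ s)
  ⊗ˡ    : ∀ {t s} → OccursT x t → OccursT x (t ⊗ s)
  ⊗ʳ    : ∀ {t s} → OccursT x s → OccursT x (t ⊗ s)

data Free (x : Var) : Formula → Set where
  eqˡ  : ∀ {t s} → OccursT x t → Free x (t ≐ s)
  eqʳ  : ∀ {t s} → OccursT x s → Free x (t ≐ s)
  neg  : ∀ {φ} → Free x φ → Free x (¬' φ)
  ∧ˡ   : ∀ {φ ψ} → Free x φ → Free x (φ ∧' ψ)
  ∧ʳ   : ∀ {φ ψ} → Free x ψ → Free x (φ ∧' ψ)
  ∨ˡ   : ∀ {φ ψ} → Free x φ → Free x (φ ∨' ψ)
  ∨ʳ   : ∀ {φ ψ} → Free x ψ → Free x (φ ∨' ψ)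
  ⇒ˡ   : ∀ {φ ψ} → Free x φ → Free x (φ ⇒' ψ)
  ⇒ʳ   : ∀ {φ ψ} → Free x ψ → Free x (φ ⇒' ψ)
  all  : ∀ {y φ} → x ≢ y → Free x φ → Free x (∀' y φ)
  ex   : ∀ {y φ} → x ≢ y → Free x φ → Free x (∃' y φ)

Sentence : Formula → Set
Sentence φ = ∀ x → ¬ Free x φ

-- Length |φ|: number of symbols of φ written in the usual infix notation
-- with parentheses around binary terms/formulas; every logical symbol,
-- parenthesis, variable and language symbol counts as one symbol.

∣_∣ₜ : Term → ℕ
∣ var x ∣ₜ = 1
∣ 𝟘 ∣ₜ = 1
∣ 𝟙 ∣ₜ = 1
∣ t ⊕ s ∣ₜ = 3 + ∣ t ∣ₜ + ∣ s ∣ₜ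
∣ t ⊗ s ∣ₜ = 3 + ∣ t ∣ₜ + ∣ s ∣ₜ

∣_∣ : Formula → ℕ
∣ t ≐ s ∣ = 1 + ∣ t ∣ₜ + ∣ s ∣ₜ
∣ ¬' φ ∣ = 1 + ∣ φ ∣
∣ φ ∧' ψ ∣ = 3 + ∣ φ ∣ + ∣ ψ ∣
∣ φ ∨' ψ ∣ = 3 + ∣ φ ∣ + ∣ ψ ∣
∣ φ ⇒' ψ ∣ = 3 + ∣ φ ∣ + ∣ ψ ∣
∣ ∀' x φ ∣ = 2 + ∣ φ ∣
∣ ∃' x φ ∣ = 2 + ∣ φ ∣

-- L-structures (equality interpreted as identity of the carrier)

record Structure : Set₁ where
  field
    Carrier : Set
    zeroᴹ oneᴹ : Carrier
    addᴹ mulᴹ : Carrier → Carrier → Carrier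

open Structure

module _ (M : Structure) where
  Assignment : Set
  Assignment = Var → Carrier M

  update : Assignment → Var → Carrier M → Assignment
  update ρ x a y with Data.Nat._≟_ x y
  ... | Relation.Nullary.yes _ = a
  ... | Relation.Nullary.no _ = ρ y

  evalT : Assignment → Term → Carrier M
  evalT ρ (var x) = ρ x
  evalT ρ 𝟘 = zeroᴹ M
  evalT ρ 𝟙 = oneᴹ M
  evalT ρ (t ⊕ s) = addᴹ M (evalT ρ t) (evalT ρ s)
  evalT ρ (t ⊗ s) = mulᴹ M (evalT ρ t) (evalT ρ s)

  -- Classical (Tarskian) satisfaction, rendered constructively via the
  -- Goedel-Gentzen negative translation (classically equivalent).
  Sat : Assignment → Formula → Set
  Sat ρ (t ≐ s) = ¬ ¬ (evalT ρ t ≡ evalT ρ s)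
  Sat ρ (¬' φ) = ¬ Sat ρ φ
  Sat ρ (φ ∧' ψ) = Sat ρ φ × Sat ρ ψ
  Sat ρ (φ ∨' ψ) = ¬ (¬ Sat ρ φ × ¬ Sat ρ ψ)
  Sat ρ (φ ⇒' ψ) = Sat ρ φ → Sat ρ ψ
  Sat ρ (∀' x φ) = (a : Carrier M) → Sat (update ρ x a) φ
  Sat ρ (∃' x φ) = ¬ ((a : Carrier M) → ¬ Sat (update ρ x a) φ)

-- M ⊨ φ for a sentence φ (the assignment is irrelevant; structures of
-- this language are nonempty, so we use the constant assignment 0).
_⊨_ : Structure → Formula → Set
M ⊨ φ = Sat M (λ _ → zeroᴹ M) φ

record Iso (A B : Structure) : Set where
  field
    f : Carrier A → Carrier B
    bij : Bijective _≡_ _≡_ f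
    pres0 : f (zeroᴹ A) ≡ zeroᴹ B
    pres1 : f (oneᴹ A) ≡ oneᴹ B
    pres+ : ∀ a b → f (addᴹ A a b) ≡ addᴹ B (f a) (f b)
    pres× : ∀ a b → f (mulᴹ A a b) ≡ mulᴹ B (f a) (f b)

Describes : Structure → Formula → Set₁
Describes M φ = Sentence φ × (M ⊨ φ) × ((N : Structure) → N ⊨ φ → ¬ ¬ Iso N M)

𝔽 : (q : ℕ) → Prime q → Structure
𝔽 q pq = record
  { Carrier = Fin q
  ; zeroᴹ = 0 mod q
  ; oneᴹ = 1 mod q
  ; addᴹ = λ a b → (toℕ a + toℕ b) mod q
  ; mulᴹ = λ a b → (toℕ a * toℕ b) mod q
  }
  where instance _ = prime⇒nonZero pq

log : ℕ → ℕ
log m = ⌈log₂ m ⌉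

-- Chebyshev: 2ⁿ ≤ (2n choose n), and by Legendre's formula every prime power dividing
-- (2n choose n) is at most 2n, so there are at least 2ʲ/(j+1) primes up to 2ʲ⁺¹.
-- Renaming the variables of a formula of length at most n to their positions gives an equivalent
-- formula whose Polish-notation encoding, padded, is a word of length n over n + 12 symbols.
-- A sentence describing 𝔽_q holds in 𝔽_q and in no other 𝔽_q′, so a word describes at most one
-- prime. For n = 2ᵃ with a = N + 4 there are at most 2^(2na) such words but more primes in
-- [N, N + 2^(8na+1)], so one of these primes q has no description of length ≤ n. Every description
-- φ of 𝔽_q then has ∣φ∣ > n, and log q ≤ 8na + 2 ≤ 8 ∣φ∣ log ∣φ∣.

module Submission where

open import Defs
open import Data.Nat
open import Data.Nat.Properties
open import Data.Nat.Combinatorics using (_C_; nCk≡n!/k![n-k]!; k![n∸k]!∣n!)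
open import Data.Nat.Divisibility
open import Data.Nat.DivMod using (_/_; m/n*n≡m)
open import Data.Nat.Induction using (<-rec)
open import Data.Nat.ListAction using (product)
open import Data.Nat.Logarithm using (⌈log₂_⌉; ⌈log₂⌉-mono-≤; ⌈log₂2^n⌉≡n)
open import Data.Nat.Primality using (Prime; prime?; euclidsLemma; prime⇒nonZero; prime⇒nonTrivial)
open import Data.Nat.Primality.Factorisation using (factorise)
open import Data.Nat.Tactic.RingSolver using (solve-∀)
open import Data.Empty using (⊥-elim)
open import Data.Fin using (Fin; toℕ; fromℕ<)
import Data.Fin as Fin
open import Data.Fin.Properties using (toℕ<n; toℕ-injective; toℕ-fromℕ<; all?; pigeonhole; cantor-schröder-bernstein)
open import Data.List using (List; []; _∷_; length; _++_; map; allFin; lookup; replicate; upTo; cartesianProductWith)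
open import Data.List.Properties using (length-++; length-map; length-replicate; length-tabulate; length-upTo; ++-assoc)
open import Data.List.Membership.Propositional using (_∈_; lose; find)
open import Data.List.Membership.Propositional.Properties
  using (∈-++⁺ˡ; ∈-++⁺ʳ; ∈-map⁺; ∈-allFin; ∈-upTo⁺; ∈-lookup; ∈-cartesianProductWith⁺)
open import Data.List.Membership.DecPropositional _≟_ using (_∈?_)
open import Data.List.Relation.Unary.All as All using (All; []; _∷_)
open import Data.List.Relation.Unary.All.Properties.Core using (¬All⇒Any¬)
open import Data.List.Relation.Unary.Any as Any using (Any; here; there; any?; index)
open import Data.List.Relation.Unary.Any.Properties using (lookup-index)
open import Data.List.Relation.Unary.AllPairs using (AllPairs; []; _∷_)
open import Data.Maybe using (Maybe; just; nothing; _>>=_)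
import Data.Maybe.Relation.Unary.Any as Maybe
open import Data.Product using (Σ; _×_; _,_; proj₁; proj₂; ∃-syntax)
open import Data.Product.Function.NonDependent.Propositional using (_×-⇔_)
open import Data.Sum using (_⊎_; inj₁; inj₂; [_,_]′)
open import Data.Unit using (⊤; tt)
open import Function using (_∘_)
open import Function.Bundles using (_⇔_; mk⇔; Equivalence; Injection; mk⤖)
open import Function.Definitions using (Bijective)
open import Function.Properties.Bijection using (⤖⇒↔)
open import Function.Properties.Inverse using (↔-sym; ↔⇒↣)
open import Function.Related.TypeIsomorphisms using (¬-cong-⇔; →-cong-⇔)
open import Relation.Binary using (DecidableEquality)
open import Relation.Binary.PropositionalEquality
open import Relation.Nullary using (¬_; Dec; yes; no)
open import Relation.Nullary.Decidable using (¬?; _×-dec_; _→-dec_; decidable-stable)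
open import Relation.Unary using (Decidable)
open import Algebra.Properties.CommutativeSemigroup +-commutativeSemigroup
  using () renaming (interchange to +-interchange)
open import Algebra.Properties.CommutativeSemigroup *-commutativeSemigroup
  using () renaming (interchange to *-interchange)

open Structure

-- Legendre's formula and Chebyshev's bound

𝟙[_] : ∀ {a} {A : Set a} → Dec A → ℕ
𝟙[ yes _ ] = 1
𝟙[ no _ ] = 0

𝟙[]≤1 : ∀ {a} {A : Set a} (d : Dec A) → 𝟙[ d ] ≤ 1
𝟙[]≤1 (yes _) = ≤-refl
𝟙[]≤1 (no _) = z≤n

∑₁ : (ℕ → ℕ) → ℕ → ℕ
∑₁ f zero = 0
∑₁ f (suc R) = ∑₁ f R + f (suc R)

∑₁-zero : ∀ R → ∑₁ (λ _ → 0) R ≡ 0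
∑₁-zero zero = refl
∑₁-zero (suc R) = trans (+-identityʳ _) (∑₁-zero R)

∑₁-distrib-+ : ∀ f g R → ∑₁ (λ i → f i + g i) R ≡ ∑₁ f R + ∑₁ g R
∑₁-distrib-+ f g zero = refl
∑₁-distrib-+ f g (suc R) =
  trans (cong (_+ (f (suc R) + g (suc R))) (∑₁-distrib-+ f g R)) (+-interchange (∑₁ f R) (∑₁ g R) (f (suc R)) (g (suc R)))

∑₁-cong : ∀ {f g} R → (∀ i → f (suc i) ≡ g (suc i)) → ∑₁ f R ≡ ∑₁ g R
∑₁-cong zero f≡g = refl
∑₁-cong (suc R) f≡g = cong₂ _+_ (∑₁-cong R f≡g) (f≡g R)

∑₁-mono-≤ : ∀ {f g} R → (∀ i → f (suc i) ≤ g (suc i)) → ∑₁ f R ≤ ∑₁ g R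
∑₁-mono-≤ zero f≤g = z≤n
∑₁-mono-≤ (suc R) f≤g = +-mono-≤ (∑₁-mono-≤ R f≤g) (f≤g R)

∑₁-𝟙≤ : ∀ {a} {A : ℕ → Set a} (A? : ∀ i → Dec (A i)) R → ∑₁ (λ i → 𝟙[ A? i ]) R ≤ R
∑₁-𝟙≤ A? zero = z≤n
∑₁-𝟙≤ A? (suc R) = subst (∑₁ (λ i → 𝟙[ A? i ]) (suc R) ≤_) (+-comm R 1) (+-mono-≤ (∑₁-𝟙≤ A? R) (𝟙[]≤1 (A? (suc R))))

∑₁-𝟙[≤] : ∀ v R → ∑₁ (λ i → 𝟙[ i ≤? v ]) R ≡ R ⊓ v
∑₁-𝟙[≤] v zero = refl
∑₁-𝟙[≤] v (suc R) with suc R ≤? v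
... | yes R<v = begin
  ∑₁ (λ i → 𝟙[ i ≤? v ]) R + 1 ≡⟨ cong (_+ 1) (∑₁-𝟙[≤] v R) ⟩
  R ⊓ v + 1                    ≡⟨ cong (_+ 1) (m≤n⇒m⊓n≡m (<⇒≤ R<v)) ⟩
  R + 1                        ≡⟨ +-comm R 1 ⟩
  suc R                        ≡⟨ m≤n⇒m⊓n≡m R<v ⟨
  suc R ⊓ v                    ∎
  where open ≡-Reasoning
... | no R≮v = begin
  ∑₁ (λ i → 𝟙[ i ≤? v ]) R + 0 ≡⟨ +-identityʳ _ ⟩
  ∑₁ (λ i → 𝟙[ i ≤? v ]) R     ≡⟨ ∑₁-𝟙[≤] v R ⟩
  R ⊓ v                        ≡⟨ m≥n⇒m⊓n≡n v≤R ⟩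
  v                            ≡⟨ m≥n⇒m⊓n≡n (m≤n⇒m≤1+n v≤R) ⟨
  suc R ⊓ v                    ∎
  where
  open ≡-Reasoning
  v≤R : v ≤ R
  v≤R = ≤-pred (≰⇒> R≮v)

multiples : ℕ → ℕ → ℕ
multiples d zero = 0
multiples d (suc m) = 𝟙[ d ∣? suc m ] + multiples d m

multiples-floor : ∀ d .{{_ : NonZero d}} m → multiples d m * d ≤ m × m < suc (multiples d m) * d
multiples-floor d zero = z≤n , subst (0 <_) (sym (*-identityˡ d)) (>-nonZero⁻¹ d)
multiples-floor d (suc m) with d ∣? suc m | multiples-floor d m
... | no d∤1+m | lower , upper =
  m≤n⇒m≤1+n lower , ≤∧≢⇒< upper (λ eq → d∤1+m (divides (suc (multiples d m)) eq))
... | yes (divides j 1+m≡j*d) | lower , upper =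
  ≤-reflexive c+1≡1+m , subst (_< suc (suc c) * d) c+1≡1+m (m<n+m (suc c * d) (>-nonZero⁻¹ d))
  where
  c = multiples d m
  c+1≡1+m : suc c * d ≡ suc m
  c+1≡1+m = trans (cong (_* d) (≤-antisym
              (*-cancelʳ-< d c j (≤-<-trans lower (subst (m <_) 1+m≡j*d (n<1+n m))))
              (*-cancelʳ-≤ j (suc c) d (subst (_≤ suc c * d) 1+m≡j*d upper))))
            (sym 1+m≡j*d)

multiples-double : ∀ d .{{_ : NonZero d}} n →
                   multiples d (n + n) ≤ multiples d n + multiples d n + 𝟙[ d ≤? n + n ]
multiples-double d n with d ≤? n + n
... | yes _ = subst (multiples d (n + n) ≤_) (+-comm 1 (c + c)) (≤-trans (≤-pred 2n/d<2c+2) (≤-reflexive (+-suc c c)))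
  where
  c = multiples d n
  2n/d<2c+2 : multiples d (n + n) < suc c + suc c
  2n/d<2c+2 = *-cancelʳ-< d _ (suc c + suc c) (≤-<-trans (proj₁ (multiples-floor d (n + n)))
    (subst (n + n <_) (sym (*-distribʳ-+ d (suc c) (suc c)))
      (+-mono-< (proj₂ (multiples-floor d n)) (proj₂ (multiples-floor d n)))))
... | no d≰2n = subst (_≤ multiples d n + multiples d n + 0) (sym (n<1⇒n≡0 2n/d<1)) z≤n
  where
  2n/d<1 : multiples d (n + n) < 1
  2n/d<1 = *-cancelʳ-< d _ 1 (≤-<-trans (proj₁ (multiples-floor d (n + n)))
    (subst (n + n <_) (sym (*-identityˡ d)) (≰⇒> d≰2n)))

record PowerSplit (p m : ℕ) : Set where
  constructor split
  field
    exponent cofactor : ℕ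
    m≡p^e*c : m ≡ p ^ exponent * cofactor
    p∤cofactor : ¬ p ∣ cofactor

powerSplit : ∀ {p} → 1 < p → ∀ m → 0 < m → PowerSplit p m
powerSplit {p} 1<p = <-rec (λ m → 0 < m → PowerSplit p m) step
  where
  step : ∀ m → (∀ {k} → k < m → 0 < k → PowerSplit p k) → 0 < m → PowerSplit p m
  step m rec 0<m with p ∣? m
  ... | no p∤m = split 0 m (sym (*-identityˡ m)) p∤m
  ... | yes (divides q refl) = split (suc e) c q*p≡p^[1+e]*c p∤c
    where
    0<q : 0 < q
    0<q = >-nonZero⁻¹ q {{m*n≢0⇒m≢0 q {{>-nonZero 0<m}}}}
    open PowerSplit (rec {q} (m<m*n q p {{>-nonZero 0<q}} 1<p) 0<q)
      renaming (exponent to e; cofactor to c; m≡p^e*c to q≡p^e*c; p∤cofactor to p∤c)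
    q*p≡p^[1+e]*c : q * p ≡ p ^ suc e * c
    q*p≡p^[1+e]*c = trans (*-comm q p) (trans (cong (p *_) q≡p^e*c) (sym (*-assoc p (p ^ e) c)))

prime>1 : ∀ {p} → Prime p → 1 < p
prime>1 {p} p-prime = nonTrivial⇒n>1 p {{prime⇒nonTrivial p-prime}}

^∣^*⇒≤ : ∀ {p u} → Prime p → ¬ p ∣ u → ∀ b e → p ^ b ∣ p ^ e * u → b ≤ e
^∣^*⇒≤ p-prime p∤u zero e _ = z≤n
^∣^*⇒≤ {p} {u} p-prime p∤u (suc b) zero p^[1+b]∣u =
  ⊥-elim (p∤u (m*n∣⇒m∣ p (p ^ b) (subst (p * p ^ b ∣_) (+-identityʳ u) p^[1+b]∣u)))
^∣^*⇒≤ {p} {u} p-prime p∤u (suc b) (suc e) p^[1+b]∣p^[1+e]*u = s≤s (^∣^*⇒≤ p-prime p∤u b e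
  (*-cancelˡ-∣ p {{prime⇒nonZero p-prime}} (subst (p * p ^ b ∣_) (*-assoc p (p ^ e) u) p^[1+b]∣p^[1+e]*u)))

n<m^n : ∀ {m} → 1 < m → ∀ n → n < m ^ n
n<m^n 1<m zero = z<s
n<m^n {m} 1<m (suc n) = ≤-trans (s≤s (n<m^n 1<m n)) (^-monoʳ-< m 1<m (n<1+n n))

≤-count⇒^≤ : ∀ {p} .{{_ : NonZero p}} {Y} → 1 ≤ Y → ∀ R a → a ≤ ∑₁ (λ i → 𝟙[ p ^ i ≤? Y ]) R → p ^ a ≤ Y
≤-count⇒^≤ 1≤Y zero zero _ = 1≤Y
≤-count⇒^≤ {p} {Y} 1≤Y (suc R) a a≤count with p ^ suc R ≤? Y
... | yes p^[1+R]≤Y = ≤-trans (^-monoʳ-≤ p (≤-trans a≤count count+1≤1+R)) p^[1+R]≤Y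
  where
  count+1≤1+R : ∑₁ (λ i → 𝟙[ p ^ i ≤? Y ]) R + 1 ≤ suc R
  count+1≤1+R = subst (∑₁ (λ i → 𝟙[ p ^ i ≤? Y ]) R + 1 ≤_) (+-comm R 1) (+-monoˡ-≤ 1 (∑₁-𝟙≤ (λ i → p ^ i ≤? Y) R))
... | no _ = ≤-count⇒^≤ 1≤Y R a (subst (a ≤_) (+-identityʳ _) a≤count)

centralBinomial : ℕ → ℕ
centralBinomial n = (n + n) C n

centralBinomial-split : ∀ n → (n + n) ! ≡ centralBinomial n * (n ! * n !)
centralBinomial-split n = begin
  (n + n) !                                  ≡⟨ m/n*n≡m (k![n∸k]!∣n! n≤2n) ⟨
  (n + n) ! / (n ! * [n+n∸n]!) * (n ! * [n+n∸n]!) ≡⟨ cong (_* (n ! * [n+n∸n]!)) (nCk≡n!/k![n-k]! n≤2n) ⟨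
  centralBinomial n * (n ! * [n+n∸n]!)       ≡⟨ cong (λ k → centralBinomial n * (n ! * k !)) (m+n∸m≡n n n) ⟩
  centralBinomial n * (n ! * n !)            ∎
  where
  open ≡-Reasoning
  n≤2n = m≤m+n n n
  [n+n∸n]! = (n + n ∸ n) !
  instance _ = n !* (n + n ∸ n) !≢0

module Legendre {p : ℕ} (p-prime : Prime p) where

  private instance
    p≢0 : NonZero p
    p≢0 = prime⇒nonZero p-prime

  legendreSum : ℕ → ℕ → ℕ
  legendreSum R m = ∑₁ (λ i → multiples (p ^ i) m) R

  𝟙[^∣^*]≡𝟙[≤] : ∀ {v w} → ¬ p ∣ w → ∀ k → 𝟙[ p ^ k ∣? p ^ v * w ] ≡ 𝟙[ k ≤? v ]
  𝟙[^∣^*]≡𝟙[≤] {v} {w} p∤w k with p ^ k ∣? p ^ v * w | k ≤? v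
  ... | yes _ | yes _ = refl
  ... | no _  | no _  = refl
  ... | yes p^k∣ | no k≰v = ⊥-elim (k≰v (^∣^*⇒≤ p-prime p∤w k v p^k∣))
  ... | no p^k∤ | yes k≤v = ⊥-elim (p^k∤ (∣-trans (^-∣ k≤v) (m∣m*n w)))
    where
    ^-∣ : k ≤ v → p ^ k ∣ p ^ v
    ^-∣ k≤v = divides (p ^ (v ∸ k)) (trans (cong (p ^_) (sym (m+[n∸m]≡n k≤v)))
                (trans (^-distribˡ-+-* p k (v ∸ k)) (*-comm (p ^ k) (p ^ (v ∸ k)))))

  legendreSum-suc : ∀ R m (s : PowerSplit p (suc m)) → PowerSplit.exponent s ≤ R →
                    legendreSum R (suc m) ≡ PowerSplit.exponent s + legendreSum R m
  legendreSum-suc R m (split v w 1+m≡p^v*w p∤w) v≤R = begin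
    legendreSum R (suc m)                  ≡⟨ ∑₁-distrib-+ (λ i → 𝟙[ p ^ i ∣? suc m ]) (λ i → multiples (p ^ i) m) R ⟩
    ∑₁ (λ i → 𝟙[ p ^ i ∣? suc m ]) R + ℓ   ≡⟨ cong (_+ ℓ) (∑₁-cong R indicator) ⟩
    ∑₁ (λ i → 𝟙[ i ≤? v ]) R + ℓ           ≡⟨ cong (_+ ℓ) (∑₁-𝟙[≤] v R) ⟩
    R ⊓ v + ℓ                              ≡⟨ cong (_+ ℓ) (m≥n⇒m⊓n≡n v≤R) ⟩
    v + ℓ                                  ∎
    where
    open ≡-Reasoning
    ℓ = legendreSum R m
    indicator : ∀ i → 𝟙[ p ^ suc i ∣? suc m ] ≡ 𝟙[ suc i ≤? v ]
    indicator i = trans (cong (λ k → 𝟙[ p ^ suc i ∣? k ]) 1+m≡p^v*w) (𝟙[^∣^*]≡𝟙[≤] p∤w (suc i))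

  ^≤⇒≤ : ∀ {v m} → p ^ v ≤ m → v ≤ m
  ^≤⇒≤ {v} p^v≤m = <⇒≤ (<-≤-trans (n<m^n (prime>1 p-prime) v) p^v≤m)

  factorial-split : ∀ R m → m ≤ R → Σ ℕ λ u → m ! ≡ p ^ legendreSum R m * u × ¬ p ∣ u
  factorial-split R zero _ = 1 , cong (λ e → p ^ e * 1) (sym (∑₁-zero R)) , p∤1
    where
    p∤1 : ¬ p ∣ 1
    p∤1 p∣1 = <⇒≢ (prime>1 p-prime) (sym (∣1⇒≡1 p∣1))
  factorial-split R (suc m) 1+m≤R with factorial-split R m (<⇒≤ 1+m≤R)
  ... | u , m!≡p^e*u , p∤u = w * u , [1+m]!≡ , p∤w*u
    where
    s = powerSplit (prime>1 p-prime) (suc m) z<s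
    open PowerSplit s
      renaming (exponent to v; cofactor to w; m≡p^e*c to 1+m≡p^v*w; p∤cofactor to p∤w)
    v≤R : v ≤ R
    v≤R = ≤-trans (^≤⇒≤ (∣⇒≤ (divides w (trans 1+m≡p^v*w (*-comm (p ^ v) w))))) 1+m≤R
    p∤w*u : ¬ p ∣ w * u
    p∤w*u p∣w*u = [ p∤w , p∤u ]′ (euclidsLemma w u p-prime p∣w*u)
    [1+m]!≡ : suc m ! ≡ p ^ legendreSum R (suc m) * (w * u)
    [1+m]!≡ = begin
      suc m * m !                              ≡⟨ cong₂ _*_ 1+m≡p^v*w m!≡p^e*u ⟩
      (p ^ v * w) * (p ^ legendreSum R m * u)  ≡⟨ *-interchange (p ^ v) w (p ^ legendreSum R m) u ⟩
      (p ^ v * p ^ legendreSum R m) * (w * u)  ≡⟨ cong (_* (w * u)) (^-distribˡ-+-* p v (legendreSum R m)) ⟨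
      p ^ (v + legendreSum R m) * (w * u)      ≡⟨ cong (λ e → p ^ e * (w * u)) (legendreSum-suc R m s v≤R) ⟨
      p ^ legendreSum R (suc m) * (w * u)      ∎
      where open ≡-Reasoning

  -- Each ⌊2n/pⁱ⌋ - 2⌊n/pⁱ⌋ is 0 or 1, and 0 once pⁱ > 2n.
  prime-power∣centralBinomial⇒≤ : ∀ n → 1 ≤ n → ∀ a → p ^ a ∣ centralBinomial n → p ^ a ≤ n + n
  prime-power∣centralBinomial⇒≤ n 1≤n a p^a∣C
    with factorial-split (n + n) n (m≤m+n n n) | factorial-split (n + n) (n + n) ≤-refl
  ... | u , n!≡p^e*u , _ | u′ , [2n]!≡p^e′*u′ , p∤u′ = ≤-count⇒^≤ (≤-trans 1≤n (m≤m+n n n)) R a a≤count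
    where
    R = n + n
    e = legendreSum R n
    e′ = legendreSum R (n + n)
    count = ∑₁ (λ i → 𝟙[ p ^ i ≤? n + n ]) R
    p^e∣n! : p ^ e ∣ n !
    p^e∣n! = divides u (trans n!≡p^e*u (*-comm (p ^ e) u))
    p^[a+2e]∣p^e′*u′ : p ^ (a + (e + e)) ∣ p ^ e′ * u′
    p^[a+2e]∣p^e′*u′ = subst₂ _∣_
      (sym (trans (^-distribˡ-+-* p a (e + e)) (cong (p ^ a *_) (^-distribˡ-+-* p e e))))
      (trans (sym (centralBinomial-split n)) [2n]!≡p^e′*u′)
      (*-pres-∣ p^a∣C (*-pres-∣ p^e∣n! p^e∣n!))
    e′≤2e+count : e′ ≤ (e + e) + count
    e′≤2e+count = ≤-trans (∑₁-mono-≤ R (λ i → multiples-double (p ^ suc i) {{m^n≢0 p (suc i)}} n))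
      (≤-reflexive (trans (∑₁-distrib-+ _ _ R) (cong (_+ count) (∑₁-distrib-+ _ _ R))))
    a≤count : a ≤ count
    a≤count = +-cancelʳ-≤ (e + e) a count (subst (a + (e + e) ≤_) (+-comm (e + e) count)
      (≤-trans (^∣^*⇒≤ p-prime p∤u′ _ _ p^[a+2e]∣p^e′*u′) e′≤2e+count))

≡1⊎prime-divisor : ∀ m .{{_ : NonZero m}} → m ≡ 1 ⊎ Σ ℕ λ p → Prime p × p ∣ m
≡1⊎prime-divisor m with factorise m
... | record { factors = [] ; isFactorisation = m≡1 } = inj₁ m≡1
... | record { factors = p ∷ ps ; isFactorisation = m≡p*ps ; factorsPrime = p-prime ∷ _ } =
  inj₂ (p , p-prime , divides (product ps) (trans m≡p*ps (*-comm p (product ps))))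

prime-power-bound : ∀ (S : List ℕ) {m Y} → 0 < m → 1 ≤ Y →
                    (∀ p → Prime p → p ∣ m → p ∈ S) →
                    (∀ p a → Prime p → p ^ a ∣ m → p ^ a ≤ Y) →
                    m ≤ Y ^ length S
prime-power-bound [] {m} 0<m 1≤Y support _ with ≡1⊎prime-divisor m {{>-nonZero 0<m}}
... | inj₁ m≡1 = ≤-reflexive m≡1
... | inj₂ (p , p-prime , p∣m) with () ← support p p-prime p∣m
prime-power-bound (s ∷ S) {m} {Y} 0<m 1≤Y support powers with prime? s
... | no ¬s-prime = ≤-trans (prime-power-bound S 0<m 1≤Y support′ powers) (m≤n*m (Y ^ length S) Y {{>-nonZero 1≤Y}})
  where
  support′ : ∀ p → Prime p → p ∣ m → p ∈ S
  support′ p p-prime p∣m with support p p-prime p∣m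
  ... | here refl = ⊥-elim (¬s-prime p-prime)
  ... | there p∈S = p∈S
... | yes s-prime = begin
  m             ≡⟨ m≡s^v*w ⟩
  s ^ v * w     ≤⟨ *-mono-≤ (powers s v s-prime s^v∣m) (prime-power-bound S 0<w 1≤Y support′ powers′) ⟩
  Y * Y ^ length S ∎
  where
  open ≤-Reasoning
  open PowerSplit (powerSplit (prime>1 s-prime) m 0<m)
    renaming (exponent to v; cofactor to w; m≡p^e*c to m≡s^v*w; p∤cofactor to s∤w)
  s^v∣m : s ^ v ∣ m
  s^v∣m = divides w (trans m≡s^v*w (*-comm (s ^ v) w))
  w∣m : w ∣ m
  w∣m = divides (s ^ v) m≡s^v*w
  0<w : 0 < w
  0<w = >-nonZero⁻¹ w {{m*n≢0⇒n≢0 (s ^ v) {{subst NonZero m≡s^v*w (>-nonZero 0<m)}}}}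
  support′ : ∀ p → Prime p → p ∣ w → p ∈ S
  support′ p p-prime p∣w with support p p-prime (∣-trans p∣w w∣m)
  ... | here refl = ⊥-elim (s∤w p∣w)
  ... | there p∈S = p∈S
  powers′ : ∀ p a → Prime p → p ^ a ∣ w → p ^ a ≤ Y
  powers′ p a p-prime p^a∣w = powers p a p-prime (∣-trans p^a∣w w∣m)

2^n*n!*n!≤[2n]! : ∀ n → 2 ^ n * (n ! * n !) ≤ (n + n) !
2^n*n!*n!≤[2n]! zero = ≤-refl
2^n*n!*n!≤[2n]! (suc n) = begin
  2 * 2 ^ n * (suc n ! * suc n !)                ≡⟨ regroup (2 ^ n) n (n !) ⟩
  (2 * suc n * suc n) * (2 ^ n * (n ! * n !))     ≤⟨ *-mono-≤ factors (2^n*n!*n!≤[2n]! n) ⟩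
  (suc (suc (n + n)) * suc (n + n)) * (n + n) !   ≡⟨ *-assoc (suc (suc (n + n))) (suc (n + n)) ((n + n) !) ⟩
  suc (suc (n + n)) * (suc (n + n) * (n + n) !)   ≡⟨ cong (λ k → suc k * k !) (+-suc n n) ⟨
  (suc n + suc n) !                               ∎
  where
  open ≤-Reasoning
  regroup : ∀ t n f → 2 * t * ((1 + n) * f * ((1 + n) * f)) ≡ (2 * (1 + n) * (1 + n)) * (t * (f * f))
  regroup = solve-∀
  factors : 2 * suc n * suc n ≤ suc (suc (n + n)) * suc (n + n)
  factors = *-mono-≤ (≤-reflexive (double-suc n)) (s≤s (m≤m+n n n))
    where
    double-suc : ∀ n → 2 * (1 + n) ≡ 2 + (n + n)
    double-suc = solve-∀

2^n≤centralBinomial : ∀ n → 2 ^ n ≤ centralBinomial n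
2^n≤centralBinomial n = *-cancelʳ-≤ (2 ^ n) (centralBinomial n) (n ! * n !) {{n !* n !≢0}}
  (subst (2 ^ n * (n ! * n !) ≤_) (centralBinomial-split n) (2^n*n!*n!≤[2n]! n))

chebyshev : ∀ j (S : List ℕ) → (∀ p → Prime p → p ≤ 2 ^ suc j → p ∈ S) → 2 ^ j ≤ suc j * length S
chebyshev j S primes∈S = subst₂ _≤_ (⌈log₂2^n⌉≡n (2 ^ j)) (⌈log₂2^n⌉≡n (suc j * length S)) (⌈log₂⌉-mono-≤ (begin
  2 ^ (2 ^ j)               ≤⟨ 2^n≤centralBinomial n ⟩
  centralBinomial n         ≤⟨ prime-power-bound S 0<C 1≤2n support powers ⟩
  (n + n) ^ length S        ≡⟨ cong (_^ length S) n+n≡2^[1+j] ⟩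
  (2 ^ suc j) ^ length S    ≡⟨ ^-*-assoc 2 (suc j) (length S) ⟩
  2 ^ (suc j * length S)    ∎))
  where
  open ≤-Reasoning
  n = 2 ^ j
  n+n≡2^[1+j] : n + n ≡ 2 ^ suc j
  n+n≡2^[1+j] = cong (n +_) (sym (+-identityʳ n))
  1≤n : 1 ≤ n
  1≤n = m^n>0 2 j
  1≤2n : 1 ≤ n + n
  1≤2n = ≤-trans 1≤n (m≤m+n n n)
  0<C : 0 < centralBinomial n
  0<C = ≤-trans (m^n>0 2 n) (2^n≤centralBinomial n)
  powers : ∀ p a → Prime p → p ^ a ∣ centralBinomial n → p ^ a ≤ n + n
  powers p a p-prime = Legendre.prime-power∣centralBinomial⇒≤ p-prime n 1≤n a
  support : ∀ p → Prime p → p ∣ centralBinomial n → p ∈ S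
  support p p-prime p∣C = primes∈S p p-prime (subst (_≤ 2 ^ suc j) (*-identityʳ p)
    (subst (p * 1 ≤_) n+n≡2^[1+j] (powers p 1 p-prime (subst (_∣ centralBinomial n) (sym (*-identityʳ p)) p∣C))))

-- Renaming variables

renameₜ : (Var → Var) → Term → Term
renameₜ σ (var x) = var (σ x)
renameₜ σ 𝟘 = 𝟘
renameₜ σ 𝟙 = 𝟙
renameₜ σ (t ⊕ s) = renameₜ σ t ⊕ renameₜ σ s
renameₜ σ (t ⊗ s) = renameₜ σ t ⊗ renameₜ σ s

rename : (Var → Var) → Formula → Formula
rename σ (t ≐ s) = renameₜ σ t ≐ renameₜ σ s
rename σ (¬' φ) = ¬' rename σ φ
rename σ (φ ∧' ψ) = rename σ φ ∧' rename σ ψ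
rename σ (φ ∨' ψ) = rename σ φ ∨' rename σ ψ
rename σ (φ ⇒' ψ) = rename σ φ ⇒' rename σ ψ
rename σ (∀' x φ) = ∀' (σ x) (rename σ φ)
rename σ (∃' x φ) = ∃' (σ x) (rename σ φ)

-- Bound as well as free occurrences count.
EveryVarₜ : (Var → Set) → Term → Set
EveryVarₜ D (var x) = D x
EveryVarₜ D 𝟘 = ⊤
EveryVarₜ D 𝟙 = ⊤
EveryVarₜ D (t ⊕ s) = EveryVarₜ D t × EveryVarₜ D s
EveryVarₜ D (t ⊗ s) = EveryVarₜ D t × EveryVarₜ D s

EveryVar : (Var → Set) → Formula → Set
EveryVar D (t ≐ s) = EveryVarₜ D t × EveryVarₜ D s
EveryVar D (¬' φ) = EveryVar D φ
EveryVar D (φ ∧' ψ) = EveryVar D φ × EveryVar D ψ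
EveryVar D (φ ∨' ψ) = EveryVar D φ × EveryVar D ψ
EveryVar D (φ ⇒' ψ) = EveryVar D φ × EveryVar D ψ
EveryVar D (∀' x φ) = D x × EveryVar D φ
EveryVar D (∃' x φ) = D x × EveryVar D φ

Π-cong-⇔ : ∀ {A : Set} {B C : A → Set} → (∀ a → B a ⇔ C a) → ((a : A) → B a) ⇔ ((a : A) → C a)
Π-cong-⇔ B⇔C = mk⇔ (λ f a → Equivalence.to (B⇔C a) (f a)) (λ g a → Equivalence.from (B⇔C a) (g a))

module Renaming (M : Structure) {D : Var → Set} {σ : Var → Var}
                (σ-injective : ∀ {x y} → D x → D y → σ x ≡ σ y → x ≡ y) where

  Related : Assignment M → Assignment M → Set
  Related ρ ρ′ = ∀ x → D x → ρ x ≡ ρ′ (σ x)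

  related-update : ∀ {ρ ρ′} → Related ρ ρ′ → ∀ {y} → D y → ∀ a → Related (update M ρ y a) (update M ρ′ (σ y) a)
  related-update {ρ} {ρ′} related {y} Dy a x Dx with y ≟ x | σ y ≟ σ x
  ... | yes _ | yes _ = refl
  ... | no _ | no _ = related x Dx
  ... | yes y≡x | no σy≢σx = ⊥-elim (σy≢σx (cong σ y≡x))
  ... | no y≢x | yes σy≡σx = ⊥-elim (y≢x (σ-injective Dy Dx σy≡σx))

  evalT-rename : ∀ {ρ ρ′} → Related ρ ρ′ → ∀ t → EveryVarₜ D t → evalT M ρ t ≡ evalT M ρ′ (renameₜ σ t)
  evalT-rename related (var x) Dx = related x Dx
  evalT-rename related 𝟘 _ = refl
  evalT-rename related 𝟙 _ = refl
  evalT-rename related (t ⊕ s) (Dt , Ds) = cong₂ (addᴹ M) (evalT-rename related t Dt) (evalT-rename related s Ds)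
  evalT-rename related (t ⊗ s) (Dt , Ds) = cong₂ (mulᴹ M) (evalT-rename related t Dt) (evalT-rename related s Ds)

  Sat-rename : ∀ {ρ ρ′} → Related ρ ρ′ → ∀ φ → EveryVar D φ → Sat M ρ φ ⇔ Sat M ρ′ (rename σ φ)
  Sat-rename related (t ≐ s) (Dt , Ds) =
    ¬-cong-⇔ (¬-cong-⇔ (mk⇔ (subst₂ _≡_ t≡t′ s≡s′) (subst₂ _≡_ (sym t≡t′) (sym s≡s′))))
    where
    t≡t′ = evalT-rename related t Dt
    s≡s′ = evalT-rename related s Ds
  Sat-rename related (¬' φ) Dφ = ¬-cong-⇔ (Sat-rename related φ Dφ)
  Sat-rename related (φ ∧' ψ) (Dφ , Dψ) = Sat-rename related φ Dφ ×-⇔ Sat-rename related ψ Dψ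
  Sat-rename related (φ ∨' ψ) (Dφ , Dψ) =
    ¬-cong-⇔ (¬-cong-⇔ (Sat-rename related φ Dφ) ×-⇔ ¬-cong-⇔ (Sat-rename related ψ Dψ))
  Sat-rename related (φ ⇒' ψ) (Dφ , Dψ) = →-cong-⇔ (Sat-rename related φ Dφ) (Sat-rename related ψ Dψ)
  Sat-rename related (∀' y φ) (Dy , Dφ) = Π-cong-⇔ λ a → Sat-rename (related-update related Dy a) φ Dφ
  Sat-rename related (∃' y φ) (Dy , Dφ) =
    ¬-cong-⇔ (Π-cong-⇔ λ a → ¬-cong-⇔ (Sat-rename (related-update related Dy a) φ Dφ))

varsₜ : Term → List Var
varsₜ (var x) = x ∷ []
varsₜ 𝟘 = []
varsₜ 𝟙 = []
varsₜ (t ⊕ s) = varsₜ t ++ varsₜ s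
varsₜ (t ⊗ s) = varsₜ t ++ varsₜ s

vars : Formula → List Var
vars (t ≐ s) = varsₜ t ++ varsₜ s
vars (¬' φ) = vars φ
vars (φ ∧' ψ) = vars φ ++ vars ψ
vars (φ ∨' ψ) = vars φ ++ vars ψ
vars (φ ⇒' ψ) = vars φ ++ vars ψ
vars (∀' x φ) = x ∷ vars φ
vars (∃' x φ) = x ∷ vars φ

EveryVarₜ-mono : ∀ {D D′ : Var → Set} → (∀ {x} → D x → D′ x) → ∀ t → EveryVarₜ D t → EveryVarₜ D′ t
EveryVarₜ-mono D⊆D′ (var x) Dx = D⊆D′ Dx
EveryVarₜ-mono D⊆D′ 𝟘 _ = tt
EveryVarₜ-mono D⊆D′ 𝟙 _ = tt
EveryVarₜ-mono D⊆D′ (t ⊕ s) (Dt , Ds) = EveryVarₜ-mono D⊆D′ t Dt , EveryVarₜ-mono D⊆D′ s Ds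
EveryVarₜ-mono D⊆D′ (t ⊗ s) (Dt , Ds) = EveryVarₜ-mono D⊆D′ t Dt , EveryVarₜ-mono D⊆D′ s Ds

EveryVar-mono : ∀ {D D′ : Var → Set} → (∀ {x} → D x → D′ x) → ∀ φ → EveryVar D φ → EveryVar D′ φ
EveryVar-mono D⊆D′ (t ≐ s) (Dt , Ds) = EveryVarₜ-mono D⊆D′ t Dt , EveryVarₜ-mono D⊆D′ s Ds
EveryVar-mono D⊆D′ (¬' φ) Dφ = EveryVar-mono D⊆D′ φ Dφ
EveryVar-mono D⊆D′ (φ ∧' ψ) (Dφ , Dψ) = EveryVar-mono D⊆D′ φ Dφ , EveryVar-mono D⊆D′ ψ Dψ
EveryVar-mono D⊆D′ (φ ∨' ψ) (Dφ , Dψ) = EveryVar-mono D⊆D′ φ Dφ , EveryVar-mono D⊆D′ ψ Dψ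
EveryVar-mono D⊆D′ (φ ⇒' ψ) (Dφ , Dψ) = EveryVar-mono D⊆D′ φ Dφ , EveryVar-mono D⊆D′ ψ Dψ
EveryVar-mono D⊆D′ (∀' x φ) (Dx , Dφ) = D⊆D′ Dx , EveryVar-mono D⊆D′ φ Dφ
EveryVar-mono D⊆D′ (∃' x φ) (Dx , Dφ) = D⊆D′ Dx , EveryVar-mono D⊆D′ φ Dφ

every-varₜ-∈ : ∀ t → EveryVarₜ (_∈ varsₜ t) t
every-varₜ-∈ (var x) = here refl
every-varₜ-∈ 𝟘 = tt
every-varₜ-∈ 𝟙 = tt
every-varₜ-∈ (t ⊕ s) = EveryVarₜ-mono ∈-++⁺ˡ t (every-varₜ-∈ t) , EveryVarₜ-mono (∈-++⁺ʳ (varsₜ t)) s (every-varₜ-∈ s)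
every-varₜ-∈ (t ⊗ s) = EveryVarₜ-mono ∈-++⁺ˡ t (every-varₜ-∈ t) , EveryVarₜ-mono (∈-++⁺ʳ (varsₜ t)) s (every-varₜ-∈ s)

every-var-∈ : ∀ φ → EveryVar (_∈ vars φ) φ
every-var-∈ (t ≐ s) = EveryVarₜ-mono ∈-++⁺ˡ t (every-varₜ-∈ t) , EveryVarₜ-mono (∈-++⁺ʳ (varsₜ t)) s (every-varₜ-∈ s)
every-var-∈ (¬' φ) = every-var-∈ φ
every-var-∈ (φ ∧' ψ) = EveryVar-mono ∈-++⁺ˡ φ (every-var-∈ φ) , EveryVar-mono (∈-++⁺ʳ (vars φ)) ψ (every-var-∈ ψ)
every-var-∈ (φ ∨' ψ) = EveryVar-mono ∈-++⁺ˡ φ (every-var-∈ φ) , EveryVar-mono (∈-++⁺ʳ (vars φ)) ψ (every-var-∈ ψ)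
every-var-∈ (φ ⇒' ψ) = EveryVar-mono ∈-++⁺ˡ φ (every-var-∈ φ) , EveryVar-mono (∈-++⁺ʳ (vars φ)) ψ (every-var-∈ ψ)
every-var-∈ (∀' x φ) = here refl , EveryVar-mono there φ (every-var-∈ φ)
every-var-∈ (∃' x φ) = here refl , EveryVar-mono there φ (every-var-∈ φ)

length-++-≤ : ∀ {A : Set} (xs ys : List A) k {a b} → length xs ≤ a → length ys ≤ b → length (xs ++ ys) ≤ k + a + b
length-++-≤ xs ys k {a} {b} xs≤a ys≤b =
  ≤-trans (≤-reflexive (length-++ xs)) (≤-trans (+-mono-≤ xs≤a ys≤b) (+-monoˡ-≤ b (m≤n+m a k)))

length-varsₜ : ∀ t → length (varsₜ t) ≤ ∣ t ∣ₜ
length-varsₜ (var x) = ≤-refl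
length-varsₜ 𝟘 = z≤n
length-varsₜ 𝟙 = z≤n
length-varsₜ (t ⊕ s) = length-++-≤ (varsₜ t) (varsₜ s) 3 (length-varsₜ t) (length-varsₜ s)
length-varsₜ (t ⊗ s) = length-++-≤ (varsₜ t) (varsₜ s) 3 (length-varsₜ t) (length-varsₜ s)

length-vars : ∀ φ → length (vars φ) ≤ ∣ φ ∣
length-vars (t ≐ s) = length-++-≤ (varsₜ t) (varsₜ s) 1 (length-varsₜ t) (length-varsₜ s)
length-vars (¬' φ) = m≤n⇒m≤1+n (length-vars φ)
length-vars (φ ∧' ψ) = length-++-≤ (vars φ) (vars ψ) 3 (length-vars φ) (length-vars ψ)
length-vars (φ ∨' ψ) = length-++-≤ (vars φ) (vars ψ) 3 (length-vars φ) (length-vars ψ)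
length-vars (φ ⇒' ψ) = length-++-≤ (vars φ) (vars ψ) 3 (length-vars φ) (length-vars ψ)
length-vars (∀' x φ) = s≤s (m≤n⇒m≤1+n (length-vars φ))
length-vars (∃' x φ) = s≤s (m≤n⇒m≤1+n (length-vars φ))

positionIn : List ℕ → ℕ → ℕ
positionIn L x with x ∈? L
... | yes x∈L = toℕ (index x∈L)
... | no _ = 0

positionIn<length : ∀ {L x} → x ∈ L → positionIn L x < length L
positionIn<length {L} {x} x∈L with x ∈? L
... | yes x∈L′ = toℕ<n (index x∈L′)
... | no x∉L = ⊥-elim (x∉L x∈L)

positionIn-injective : ∀ {L x y} → x ∈ L → y ∈ L → positionIn L x ≡ positionIn L y → x ≡ y
positionIn-injective {L} {x} {y} x∈L y∈L eq with x ∈? L | y ∈? L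
... | yes i | yes j = trans (lookup-index i) (trans (cong (lookup L) (toℕ-injective eq)) (sym (lookup-index j)))
... | no x∉L | _ = ⊥-elim (x∉L x∈L)
... | _ | no y∉L = ⊥-elim (y∉L y∈L)

cap : ∀ n → ℕ → Fin (suc n)
cap n x = fromℕ< (s≤s (m⊓n≤n x n))

toℕ-cap : ∀ {n x} → x ≤ n → toℕ (cap n x) ≡ x
toℕ-cap {n} {x} x≤n = trans (toℕ-fromℕ< _) (m≤n⇒m⊓n≡m x≤n)

-- Encoding formulas as words

-- Polish notation needs no parentheses, so encodings are no longer than ∣_∣; parsing leaves
-- trailing symbols unread, so encodings can be padded.
data Symbol (V : ℕ) : Set where
  symVar : Fin V → Symbol V
  sym𝟘 sym𝟙 sym⊕ sym⊗ sym≐ sym¬ sym∧ sym∨ sym⇒ sym∀ sym∃ : Symbol V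

Word : ℕ → Set
Word V = List (Symbol V)

module Encoding {V : ℕ} (τ : Var → Fin V) where

  encodeₜ : Term → Word V
  encodeₜ (var x) = symVar (τ x) ∷ []
  encodeₜ 𝟘 = sym𝟘 ∷ []
  encodeₜ 𝟙 = sym𝟙 ∷ []
  encodeₜ (t ⊕ s) = sym⊕ ∷ encodeₜ t ++ encodeₜ s
  encodeₜ (t ⊗ s) = sym⊗ ∷ encodeₜ t ++ encodeₜ s

  encode : Formula → Word V
  encode (t ≐ s) = sym≐ ∷ encodeₜ t ++ encodeₜ s
  encode (¬' φ) = sym¬ ∷ encode φ
  encode (φ ∧' ψ) = sym∧ ∷ encode φ ++ encode ψ
  encode (φ ∨' ψ) = sym∨ ∷ encode φ ++ encode ψ
  encode (φ ⇒' ψ) = sym⇒ ∷ encode φ ++ encode ψ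
  encode (∀' x φ) = sym∀ ∷ symVar (τ x) ∷ encode φ
  encode (∃' x φ) = sym∃ ∷ symVar (τ x) ∷ encode φ

  length-encodeₜ : ∀ t → length (encodeₜ t) ≤ ∣ t ∣ₜ
  length-encodeₜ (var x) = ≤-refl
  length-encodeₜ 𝟘 = ≤-refl
  length-encodeₜ 𝟙 = ≤-refl
  length-encodeₜ (t ⊕ s) = s≤s (length-++-≤ (encodeₜ t) (encodeₜ s) 2 (length-encodeₜ t) (length-encodeₜ s))
  length-encodeₜ (t ⊗ s) = s≤s (length-++-≤ (encodeₜ t) (encodeₜ s) 2 (length-encodeₜ t) (length-encodeₜ s))

  length-encode : ∀ φ → length (encode φ) ≤ ∣ φ ∣
  length-encode (t ≐ s) = s≤s (length-++-≤ (encodeₜ t) (encodeₜ s) 0 (length-encodeₜ t) (length-encodeₜ s))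
  length-encode (¬' φ) = s≤s (length-encode φ)
  length-encode (φ ∧' ψ) = s≤s (length-++-≤ (encode φ) (encode ψ) 2 (length-encode φ) (length-encode ψ))
  length-encode (φ ∨' ψ) = s≤s (length-++-≤ (encode φ) (encode ψ) 2 (length-encode φ) (length-encode ψ))
  length-encode (φ ⇒' ψ) = s≤s (length-++-≤ (encode φ) (encode ψ) 2 (length-encode φ) (length-encode ψ))
  length-encode (∀' x φ) = s≤s (s≤s (length-encode φ))
  length-encode (∃' x φ) = s≤s (s≤s (length-encode φ))

module Parsing {V : ℕ} where

  Parser : Set → Set
  Parser A = Word V → Maybe (A × Word V)

  binary : ∀ {A B : Set} → (A → A → B) → Parser A → Parser B
  binary op p w = p w >>= λ (a , w′) → p w′ >>= λ (b , w″) → just (op a b , w″)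

  unary : ∀ {A B : Set} → (A → B) → Parser A → Parser B
  unary op p w = p w >>= λ (a , w′) → just (op a , w′)

  -- The first argument is fuel, bounding the nesting depth.
  parseₜ : ℕ → Parser Term
  parseₜ zero _ = nothing
  parseₜ (suc f) (symVar i ∷ w) = just (var (toℕ i) , w)
  parseₜ (suc f) (sym𝟘 ∷ w) = just (𝟘 , w)
  parseₜ (suc f) (sym𝟙 ∷ w) = just (𝟙 , w)
  parseₜ (suc f) (sym⊕ ∷ w) = binary _⊕_ (parseₜ f) w
  parseₜ (suc f) (sym⊗ ∷ w) = binary _⊗_ (parseₜ f) w
  parseₜ (suc f) _ = nothing

  parse : ℕ → Parser Formula
  parse zero _ = nothing
  parse (suc f) (sym≐ ∷ w) = binary _≐_ (parseₜ f) w
  parse (suc f) (sym¬ ∷ w) = unary ¬'_ (parse f) w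
  parse (suc f) (sym∧ ∷ w) = binary _∧'_ (parse f) w
  parse (suc f) (sym∨ ∷ w) = binary _∨'_ (parse f) w
  parse (suc f) (sym⇒ ∷ w) = binary _⇒'_ (parse f) w
  parse (suc f) (sym∀ ∷ symVar i ∷ w) = unary (∀' (toℕ i)) (parse f) w
  parse (suc f) (sym∃ ∷ symVar i ∷ w) = unary (∃' (toℕ i)) (parse f) w
  parse (suc f) _ = nothing

  decode : ℕ → Word V → Maybe Formula
  decode f w = parse f w >>= just ∘ proj₁

module RoundTrip {V : ℕ} (τ : Var → Fin V) where
  open Encoding τ
  open Parsing {V}

  private
    Parses : ∀ {A : Set} → Parser A → Word V → A → Set
    Parses p u a = ∀ w → p (u ++ w) ≡ just (a , w)

    unary-++ : ∀ {A B : Set} (op : A → B) (p : Parser A) {u a} → Parses p u a → Parses (unary op p) u (op a)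
    unary-++ op p p-u w rewrite p-u w = refl

    binary-++ : ∀ {A B : Set} (op : A → A → B) (p : Parser A) {u v a b} →
                Parses p u a → Parses p v b → Parses (binary op p) (u ++ v) (op a b)
    binary-++ op p {u} {v} p-u p-v w rewrite ++-assoc u v w | p-u (v ++ w) | p-v w = refl

    fuelˡ : ∀ {f a b} k → suc k + a + b ≤ suc f → a ≤ f
    fuelˡ {f} {a} {b} k 1+k+a+b≤1+f = ≤-trans (m≤n+m a k) (≤-trans (m≤m+n (k + a) b) (≤-pred 1+k+a+b≤1+f))

    fuelʳ : ∀ {f a b} k → suc k + a + b ≤ suc f → b ≤ f
    fuelʳ {f} {a} {b} k 1+k+a+b≤1+f = ≤-trans (m≤n+m b (k + a)) (≤-pred 1+k+a+b≤1+f)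

  parseₜ-encodeₜ : ∀ f t → ∣ t ∣ₜ ≤ f → Parses (parseₜ f) (encodeₜ t) (renameₜ (toℕ ∘ τ) t)
  parseₜ-encodeₜ (suc f) (var x) _ w = refl
  parseₜ-encodeₜ (suc f) 𝟘 _ w = refl
  parseₜ-encodeₜ (suc f) 𝟙 _ w = refl
  parseₜ-encodeₜ (suc f) (t ⊕ s) ∣t⊕s∣≤1+f =
    binary-++ _⊕_ (parseₜ f) (parseₜ-encodeₜ f t (fuelˡ 2 ∣t⊕s∣≤1+f)) (parseₜ-encodeₜ f s (fuelʳ 2 ∣t⊕s∣≤1+f))
  parseₜ-encodeₜ (suc f) (t ⊗ s) ∣t⊗s∣≤1+f =
    binary-++ _⊗_ (parseₜ f) (parseₜ-encodeₜ f t (fuelˡ 2 ∣t⊗s∣≤1+f)) (parseₜ-encodeₜ f s (fuelʳ 2 ∣t⊗s∣≤1+f))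

  parse-encode : ∀ f φ → ∣ φ ∣ ≤ f → Parses (parse f) (encode φ) (rename (toℕ ∘ τ) φ)
  parse-encode (suc f) (t ≐ s) ∣t≐s∣≤1+f =
    binary-++ _≐_ (parseₜ f) (parseₜ-encodeₜ f t (fuelˡ 0 ∣t≐s∣≤1+f)) (parseₜ-encodeₜ f s (fuelʳ 0 ∣t≐s∣≤1+f))
  parse-encode (suc f) (¬' φ) ∣¬φ∣≤1+f = unary-++ ¬'_ (parse f) (parse-encode f φ (≤-pred ∣¬φ∣≤1+f))
  parse-encode (suc f) (φ ∧' ψ) ∣φ∧ψ∣≤1+f =
    binary-++ _∧'_ (parse f) (parse-encode f φ (fuelˡ 2 ∣φ∧ψ∣≤1+f)) (parse-encode f ψ (fuelʳ 2 ∣φ∧ψ∣≤1+f))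
  parse-encode (suc f) (φ ∨' ψ) ∣φ∨ψ∣≤1+f =
    binary-++ _∨'_ (parse f) (parse-encode f φ (fuelˡ 2 ∣φ∨ψ∣≤1+f)) (parse-encode f ψ (fuelʳ 2 ∣φ∨ψ∣≤1+f))
  parse-encode (suc f) (φ ⇒' ψ) ∣φ⇒ψ∣≤1+f =
    binary-++ _⇒'_ (parse f) (parse-encode f φ (fuelˡ 2 ∣φ⇒ψ∣≤1+f)) (parse-encode f ψ (fuelʳ 2 ∣φ⇒ψ∣≤1+f))
  parse-encode (suc f) (∀' x φ) ∣∀φ∣≤1+f =
    unary-++ (∀' (toℕ (τ x))) (parse f) (parse-encode f φ (m+n≤o⇒n≤o 1 (≤-pred ∣∀φ∣≤1+f)))
  parse-encode (suc f) (∃' x φ) ∣∃φ∣≤1+f =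
    unary-++ (∃' (toℕ (τ x))) (parse f) (parse-encode f φ (m+n≤o⇒n≤o 1 (≤-pred ∣∃φ∣≤1+f)))

  decode-encode : ∀ f φ w → ∣ φ ∣ ≤ f → decode f (encode φ ++ w) ≡ just (rename (toℕ ∘ τ) φ)
  decode-encode f φ w ∣φ∣≤f = cong (_>>= just ∘ proj₁) (parse-encode f φ ∣φ∣≤f w)

length-cartesianProductWith : ∀ {A B C : Set} (f : A → B → C) xs ys →
                              length (cartesianProductWith f xs ys) ≡ length xs * length ys
length-cartesianProductWith f [] ys = refl
length-cartesianProductWith f (x ∷ xs) ys =
  trans (length-++ (map (f x) ys)) (cong₂ _+_ (length-map (f x) ys) (length-cartesianProductWith f xs ys))

module Words (V : ℕ) where

  symbols : List (Symbol V)
  symbols = map symVar (allFin V) ++ sym𝟘 ∷ sym𝟙 ∷ sym⊕ ∷ sym⊗ ∷ sym≐ ∷ sym¬ ∷ sym∧ ∷ sym∨ ∷ sym⇒ ∷ sym∀ ∷ sym∃ ∷ []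

  length-symbols : length symbols ≡ V + 11
  length-symbols = trans (length-++ (map symVar (allFin V)))
    (cong (_+ 11) (trans (length-map symVar (allFin V)) (length-tabulate {n = V} (λ i → i))))

  ∈-symbols : ∀ s → s ∈ symbols
  ∈-symbols (symVar i) = ∈-++⁺ˡ (∈-map⁺ symVar (∈-allFin i))
  ∈-symbols sym𝟘 = ∈-++⁺ʳ _ (here refl)
  ∈-symbols sym𝟙 = ∈-++⁺ʳ _ (there (here refl))
  ∈-symbols sym⊕ = ∈-++⁺ʳ _ (there (there (here refl)))
  ∈-symbols sym⊗ = ∈-++⁺ʳ _ (there (there (there (here refl))))
  ∈-symbols sym≐ = ∈-++⁺ʳ _ (there (there (there (there (here refl)))))
  ∈-symbols sym¬ = ∈-++⁺ʳ _ (there (there (there (there (there (here refl))))))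
  ∈-symbols sym∧ = ∈-++⁺ʳ _ (there (there (there (there (there (there (here refl)))))))
  ∈-symbols sym∨ = ∈-++⁺ʳ _ (there (there (there (there (there (there (there (here refl))))))))
  ∈-symbols sym⇒ = ∈-++⁺ʳ _ (there (there (there (there (there (there (there (there (here refl)))))))))
  ∈-symbols sym∀ = ∈-++⁺ʳ _ (there (there (there (there (there (there (there (there (there (here refl))))))))))
  ∈-symbols sym∃ = ∈-++⁺ʳ _ (there (there (there (there (there (there (there (there (there (there (here refl)))))))))))

  words : ℕ → List (Word V)
  words zero = [] ∷ []
  words (suc n) = cartesianProductWith _∷_ symbols (words n)

  length-words : ∀ n → length (words n) ≡ (V + 11) ^ n
  length-words zero = refl
  length-words (suc n) =
    trans (length-cartesianProductWith _∷_ symbols (words n)) (cong₂ _*_ length-symbols (length-words n))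

  ∈-words : ∀ (w : Word V) → w ∈ words (length w)
  ∈-words [] = here refl
  ∈-words (s ∷ w) = ∈-cartesianProductWith⁺ _∷_ (∈-symbols s) (∈-words w)

-- Finite fields

module Decision (M : Structure) (_≟ᴹ_ : DecidableEquality (Carrier M))
                (∀? : ∀ {P : Carrier M → Set} → Decidable P → Dec (∀ a → P a)) where

  Sat? : ∀ ρ φ → Dec (Sat M ρ φ)
  Sat? ρ (t ≐ s) = ¬? (¬? (evalT M ρ t ≟ᴹ evalT M ρ s))
  Sat? ρ (¬' φ) = ¬? (Sat? ρ φ)
  Sat? ρ (φ ∧' ψ) = Sat? ρ φ ×-dec Sat? ρ ψ
  Sat? ρ (φ ∨' ψ) = ¬? (¬? (Sat? ρ φ) ×-dec ¬? (Sat? ρ ψ))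
  Sat? ρ (φ ⇒' ψ) = Sat? ρ φ →-dec Sat? ρ ψ
  Sat? ρ (∀' x φ) = ∀? (λ a → Sat? (update M ρ x a) φ)
  Sat? ρ (∃' x φ) = ¬? (∀? (λ a → ¬? (Sat? (update M ρ x a) φ)))

𝔽-⊨? : ∀ q (q-prime : Prime q) φ → Dec (𝔽 q q-prime ⊨ φ)
𝔽-⊨? q q-prime = Decision.Sat? (𝔽 q q-prime) Fin._≟_ all? _

bijective⇒≡ : ∀ {m n} {f : Fin m → Fin n} → Bijective _≡_ _≡_ f → m ≡ n
bijective⇒≡ f-bijective =
  cantor-schröder-bernstein (proj₁ f-bijective) (Injection.injective (↔⇒↣ (↔-sym (⤖⇒↔ (mk⤖ f-bijective)))))

¬¬Iso-𝔽⇒≡ : ∀ {q q′ q-prime q′-prime} → ¬ ¬ Iso (𝔽 q′ q′-prime) (𝔽 q q-prime) → q′ ≡ q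
¬¬Iso-𝔽⇒≡ {q} {q′} ¬¬iso = decidable-stable (q′ ≟ q) (λ q′≢q → ¬¬iso (q′≢q ∘ bijective⇒≡ ∘ Iso.bij))

-- The counting argument

AllPairs-lookup : ∀ {A : Set} {R : A → A → Set} {xs : List A} → AllPairs R xs →
                  ∀ {i j : Fin (length xs)} → i Fin.< j → R (lookup xs i) (lookup xs j)
AllPairs-lookup (Rx ∷ _) {Fin.zero} {Fin.suc j} _ = All.lookup Rx (∈-lookup j)
AllPairs-lookup (_ ∷ pairs) {Fin.suc i} {Fin.suc j} (s≤s i<j) = AllPairs-lookup pairs i<j

module Separation {A B : Set} (key : A → ℕ) (Holds : A → B → Set) (Holds? : ∀ a w → Dec (Holds a w))
                  (candidates : List A) where

  SinglesOut : B → A → Set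
  SinglesOut w a = Holds a w × All (λ a′ → key a′ ≢ key a → ¬ Holds a′ w) candidates

  singlesOut? : ∀ w a → Dec (SinglesOut w a)
  singlesOut? w a = Holds? a w ×-dec All.all? (λ a′ → ¬? (key a′ ≟ key a) →-dec ¬? (Holds? a′ w)) candidates

  unsingled : AllPairs (λ a a′ → key a ≢ key a′) candidates → (W : List B) → length W < length candidates →
              Any (λ a → All (λ w → ¬ SinglesOut w a) W) candidates
  unsingled distinct W W<candidates with any? (λ a → All.all? (λ w → ¬? (singlesOut? w a)) W) candidates
  ... | yes found = found
  ... | no none = ⊥-elim (excluded-j holds-j)
    where
    witness : ∀ i → Any (λ w → SinglesOut w (lookup candidates i)) W
    witness i = Any.map (decidable-stable (singlesOut? _ _))
      (¬All⇒Any¬ (λ w → ¬? (singlesOut? w _)) W (none ∘ lose (∈-lookup i)))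
    collision = pigeonhole W<candidates (index ∘ witness)
    i = proj₁ collision
    j = proj₁ (proj₂ collision)
    w = lookup W (index (witness i))
    singles-i : SinglesOut w (lookup candidates i)
    singles-i = lookup-index (witness i)
    holds-j : Holds (lookup candidates j) w
    holds-j = subst (λ k → Holds (lookup candidates j) (lookup W k)) (sym (proj₂ (proj₂ (proj₂ collision))))
                  (proj₁ (lookup-index (witness j)))
    excluded-j : ¬ Holds (lookup candidates j) w
    excluded-j = All.lookup (proj₂ singles-i) (∈-lookup j)
      (≢-sym (AllPairs-lookup distinct (proj₁ (proj₂ (proj₂ collision)))))

primesFrom : ℕ → ℕ → List (Σ ℕ Prime)
primesFrom N zero = []
primesFrom N (suc c) with prime? N
... | yes N-prime = (N , N-prime) ∷ primesFrom (suc N) c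
... | no _ = primesFrom (suc N) c

primesFrom-≥ : ∀ N c → All (λ p → N ≤ proj₁ p) (primesFrom N c)
primesFrom-≥ N zero = []
primesFrom-≥ N (suc c) with prime? N
... | yes _ = ≤-refl ∷ All.map (≤-trans (n≤1+n N)) (primesFrom-≥ (suc N) c)
... | no _ = All.map (≤-trans (n≤1+n N)) (primesFrom-≥ (suc N) c)

primesFrom-< : ∀ N c → All (λ p → proj₁ p < N + c) (primesFrom N c)
primesFrom-< N zero = []
primesFrom-< N (suc c) with prime? N
... | yes _ = subst (N <_) (sym (+-suc N c)) (s≤s (m≤m+n N c)) 
            ∷ All.map (λ {p} → subst (proj₁ p <_) (sym (+-suc N c))) (primesFrom-< (suc N) c)
... | no _ = All.map (λ {p} → subst (proj₁ p <_) (sym (+-suc N c))) (primesFrom-< (suc N) c)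

primesFrom-distinct : ∀ N c → AllPairs (λ p p′ → proj₁ p ≢ proj₁ p′) (primesFrom N c)
primesFrom-distinct N zero = []
primesFrom-distinct N (suc c) with prime? N
... | yes _ = All.map <⇒≢ (primesFrom-≥ (suc N) c) ∷ primesFrom-distinct (suc N) c
... | no _ = primesFrom-distinct (suc N) c

primesFrom-complete : ∀ N c {p} → Prime p → N ≤ p → p < N + c → p ∈ map proj₁ (primesFrom N c)
primesFrom-complete N zero p-prime N≤p p<N+0 = ⊥-elim (<⇒≱ p<N+0 (≤-trans (≤-reflexive (+-identityʳ N)) N≤p))
primesFrom-complete N (suc c) {p} p-prime N≤p p<N+1+c with prime? N | N ≟ p
... | yes _ | yes refl = here refl
... | no N-composite | yes refl = ⊥-elim (N-composite p-prime)
... | yes _ | no N≢p = there (primesFrom-complete (suc N) c p-prime (≤∧≢⇒< N≤p N≢p) (subst (p <_) (+-suc N c) p<N+1+c))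
... | no _ | no N≢p = primesFrom-complete (suc N) c p-prime (≤∧≢⇒< N≤p N≢p) (subst (p <_) (+-suc N c) p<N+1+c)

module ShortFormulas (n : ℕ) where
  open Words (suc n)
  open Parsing {suc n}

  record Code (φ : Formula) : Set₁ where
    field
      word : Word (suc n)
      word∈words : word ∈ words n
      formula : Formula
      decode-word : decode n word ≡ just formula
      ⊨-equivalent : ∀ M → M ⊨ φ ⇔ M ⊨ formula

  -- Renaming each variable of φ to its position in vars φ makes all variables fit in Fin (suc n).
  code : ∀ φ → ∣ φ ∣ ≤ n → Code φ
  code φ ∣φ∣≤n = record
    { word = w
    ; word∈words = subst (λ k → w ∈ words k) length-w (∈-words w)
    ; formula = rename σ φ
    ; decode-word = RoundTrip.decode-encode τ n φ padding ∣φ∣≤n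
    ; ⊨-equivalent = λ M → Renaming.Sat-rename M σ-injective (λ _ _ → refl) φ (every-var-∈ φ)
    }
    where
    τ : Var → Fin (suc n)
    τ = cap n ∘ positionIn (vars φ)
    σ = toℕ ∘ τ
    open Encoding τ
    padding = replicate (n ∸ length (encode φ)) sym𝟘
    w = encode φ ++ padding
    length-w : length w ≡ n
    length-w = trans (length-++ (encode φ))
      (trans (cong (length (encode φ) +_) (length-replicate (n ∸ length (encode φ))))
             (m+[n∸m]≡n (≤-trans (length-encode φ) ∣φ∣≤n)))
    σ≡position : ∀ {x} → x ∈ vars φ → σ x ≡ positionIn (vars φ) x
    σ≡position x∈vars = toℕ-cap (≤-trans (<⇒≤ (positionIn<length x∈vars)) (≤-trans (length-vars φ) ∣φ∣≤n))
    σ-injective : ∀ {x y} → x ∈ vars φ → y ∈ vars φ → σ x ≡ σ y → x ≡ y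
    σ-injective x∈vars y∈vars σx≡σy = positionIn-injective x∈vars y∈vars
      (trans (sym (σ≡position x∈vars)) (trans σx≡σy (σ≡position y∈vars)))

2^[1+n]≡2^n+2^n : ∀ n → 2 ^ suc n ≡ 2 ^ n + 2 ^ n
2^[1+n]≡2^n+2^n n = cong (2 ^ n +_) (+-identityʳ (2 ^ n))

4t+1≤2^t : ∀ t → 5 ≤ t → suc (4 * t) ≤ 2 ^ t
4t+1≤2^t t 5≤t = subst (λ s → suc (4 * s) ≤ 2 ^ s) (m+[n∸m]≡n 5≤t) (from5 (t ∸ 5))
  where
  shift : ∀ u → suc (4 * (5 + suc u)) ≡ 4 + suc (4 * (5 + u))
  shift = solve-∀
  from5 : ∀ u → suc (4 * (5 + u)) ≤ 2 ^ (5 + u)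
  from5 zero = m≤m+n 21 11
  from5 (suc u) = begin
    suc (4 * (5 + suc u))       ≡⟨ shift u ⟩
    4 + suc (4 * (5 + u))       ≤⟨ +-mono-≤ (^-monoʳ-≤ 2 {2} {5 + u} (s≤s (s≤s z≤n))) (from5 u) ⟩
    2 ^ (5 + u) + 2 ^ (5 + u)   ≡⟨ 2^[1+n]≡2^n+2^n (5 + u) ⟨
    2 ^ (5 + suc u)             ∎
    where open ≤-Reasoning

[4t+1]*[x+y]<2^[4t] : ∀ {t x y} → 5 ≤ t → x ≤ 2 ^ t → y ≤ 2 ^ t → suc (4 * t) * (x + y) < 2 ^ (4 * t)
[4t+1]*[x+y]<2^[4t] {t} {x} {y} 5≤t x≤2^t y≤2^t = begin-strict
  suc (4 * t) * (x + y)     ≤⟨ *-mono-≤ (4t+1≤2^t t 5≤t) (+-mono-≤ x≤2^t y≤2^t) ⟩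
  2 ^ t * (2 ^ t + 2 ^ t)   ≡⟨ cong (2 ^ t *_) (2^[1+n]≡2^n+2^n t) ⟨
  2 ^ t * 2 ^ suc t         ≡⟨ ^-distribˡ-+-* 2 t (suc t) ⟨
  2 ^ (t + suc t)           <⟨ ^-monoʳ-< 2 (s≤s (s≤s z≤n)) (2t+1<4t t (≤-trans (s≤s z≤n) 5≤t)) ⟩
  2 ^ (4 * t)               ∎
  where
  open ≤-Reasoning
  expand : ∀ u → 4 * suc u ≡ suc (suc u + suc (suc u)) + (u + u)
  expand = solve-∀
  2t+1<4t : ∀ t → 1 ≤ t → t + suc t < 4 * t
  2t+1<4t (suc u) _ = subst (suc (suc u + suc (suc u)) ≤_) (sym (expand u)) (m≤m+n _ (u + u))

module PrimeWithoutShortDescription (N : ℕ) where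
  a = 4 + N
  n = 2 ^ a
  t = 2 * (n * a)
  m = 4 * t
  V = suc n

  candidates : List (Σ ℕ Prime)
  candidates = primesFrom N (suc (2 ^ suc m))

  W = Words.words V n

  Holds : Σ ℕ Prime → Word V → Set
  Holds (q , q-prime) w = Maybe.Any (𝔽 q q-prime ⊨_) (Parsing.decode n w)

  Holds? : ∀ p w → Dec (Holds p w)
  Holds? (q , q-prime) w = Maybe.dec (𝔽-⊨? q q-prime) (Parsing.decode n w)

  open Separation proj₁ Holds Holds? candidates

  instance
    n≢0 : NonZero n
    n≢0 = m^n≢0 2 a

  4≤a : 4 ≤ a
  4≤a = m≤m+n 4 N

  a≤n*a : a ≤ n * a
  a≤n*a = m≤n*m a n

  5≤t : 5 ≤ t
  5≤t = ≤-trans (m≤m+n 5 3) (*-monoʳ-≤ 2 (≤-trans 4≤a a≤n*a))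

  N≤2^t : N ≤ 2 ^ t
  N≤2^t = <⇒≤ (<-≤-trans (n<m^n (s≤s (s≤s z≤n)) N) (^-monoʳ-≤ 2 (≤-trans (m≤n+m N 4) (≤-trans a≤n*a (m≤n*m (n * a) 2)))))

  length-W≤2^t : length W ≤ 2 ^ t
  length-W≤2^t = begin
    length W             ≡⟨ Words.length-words V n ⟩
    (V + 11) ^ n         ≤⟨ ^-monoˡ-≤ n symbols≤2^[2a] ⟩
    (2 ^ (2 * a)) ^ n    ≡⟨ ^-*-assoc 2 (2 * a) n ⟩
    2 ^ (2 * a * n)      ≡⟨ cong (2 ^_) (trans (*-assoc 2 a n) (cong (2 *_) (*-comm a n))) ⟩
    2 ^ t                ∎
    where
    open ≤-Reasoning
    symbols≤2^[2a] : V + 11 ≤ 2 ^ (2 * a)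
    symbols≤2^[2a] = begin
      V + 11        ≡⟨ +-suc n 11 ⟨
      n + 12        ≤⟨ +-monoʳ-≤ n (≤-trans (m≤m+n 12 4) (^-monoʳ-≤ 2 4≤a)) ⟩
      n + n         ≡⟨ 2^[1+n]≡2^n+2^n a ⟨
      2 ^ suc a     ≤⟨ ^-monoʳ-≤ 2 {suc a} {2 * a} 1+a≤2a ⟩
      2 ^ (2 * a)   ∎
      where
      1+a≤2a : suc a ≤ 2 * a
      1+a≤2a = subst (_≤ 2 * a) (+-comm a 1) (+-monoʳ-≤ a (≤-trans (s≤s z≤n) (≤-trans 4≤a (m≤m+n a 0))))

  length-W<candidates : length W < length candidates
  length-W<candidates = ≰⇒> λ candidates≤W →
    <⇒≱ ([4t+1]*[x+y]<2^[4t] 5≤t N≤2^t (≤-trans candidates≤W length-W≤2^t))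
        (subst (λ k → 2 ^ m ≤ suc m * k) length-S (chebyshev m S primes∈S))
    where
    S = upTo N ++ map proj₁ candidates
    length-S : length S ≡ N + length candidates
    length-S = trans (length-++ (upTo N)) (cong₂ _+_ (length-upTo N) (length-map proj₁ candidates))
    primes∈S : ∀ p → Prime p → p ≤ 2 ^ suc m → p ∈ S
    primes∈S p p-prime p≤2^[1+m] with p <? N
    ... | yes p<N = ∈-++⁺ˡ (∈-upTo⁺ p<N)
    ... | no p≮N = ∈-++⁺ʳ (upTo N) (primesFrom-complete N _ p-prime (≮⇒≥ p≮N)
                     (subst (p <_) (sym (+-suc N _)) (s≤s (≤-trans p≤2^[1+m] (m≤n+m _ N)))))

  open ShortFormulas n

  code-of-description-singles-out : ∀ p (p-prime : Prime p) {φ} → Describes (𝔽 p p-prime) φ → (c : Code φ) →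
                                    SinglesOut (Code.word c) (p , p-prime)
  code-of-description-singles-out p p-prime (_ , p⊨φ , only-p) c = holds , All.tabulate excluded
    where
    open Code c
    holds : Holds (p , p-prime) word
    holds = subst (Maybe.Any _) (sym decode-word) (Maybe.just (Equivalence.to (⊨-equivalent _) p⊨φ))
    excluded : ∀ {r} → r ∈ candidates → proj₁ r ≢ p → ¬ Holds r word
    excluded {q′ , q′-prime} _ q′≢p holds′ = q′≢p (¬¬Iso-𝔽⇒≡ {q-prime = p-prime} {q′-prime} (only-p (𝔽 q′ q′-prime)
      (Equivalence.from (⊨-equivalent _) (Maybe.drop-just (subst (Maybe.Any _) decode-word holds′)))))

  picked : Σ (Σ ℕ Prime) λ p → p ∈ candidates × All (λ w → ¬ SinglesOut w p) W
  picked = find (unsingled (primesFrom-distinct N _) W length-W<candidates)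

  q : ℕ
  q = proj₁ (proj₁ picked)

  q-prime : Prime q
  q-prime = proj₂ (proj₁ picked)

  q∈candidates : proj₁ picked ∈ candidates
  q∈candidates = proj₁ (proj₂ picked)

  N≤q : N ≤ q
  N≤q = All.lookup (primesFrom-≥ N _) q∈candidates

  log-q≤2+8na : log q ≤ 2 + 8 * (n * a)
  log-q≤2+8na = begin
    ⌈log₂ q ⌉                 ≤⟨ ⌈log₂⌉-mono-≤ q≤2^[2+m] ⟩
    ⌈log₂ (2 ^ (2 + m)) ⌉     ≡⟨ ⌈log₂2^n⌉≡n (2 + m) ⟩
    2 + m                     ≡⟨ cong (2 +_) (*-assoc 4 2 (n * a)) ⟨
    2 + 8 * (n * a)           ∎
    where
    open ≤-Reasoning
    N≤2^[1+m] : N ≤ 2 ^ suc m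
    N≤2^[1+m] = ≤-trans N≤2^t (^-monoʳ-≤ 2 (≤-trans (m≤n*m t 4) (n≤1+n m)))
    q≤2^[2+m] : q ≤ 2 ^ (2 + m)
    q≤2^[2+m] = ≤-trans (≤-pred (subst (q <_) (+-suc N _) (All.lookup (primesFrom-< N _) q∈candidates)))
                  (≤-trans (+-monoˡ-≤ _ N≤2^[1+m]) (≤-reflexive (sym (2^[1+n]≡2^n+2^n (suc m)))))

  describing-sentences-are-long : ∀ φ → Describes (𝔽 q q-prime) φ → n < ∣ φ ∣
  describing-sentences-are-long φ description = ≰⇒> λ ∣φ∣≤n →
    All.lookup (proj₂ (proj₂ picked)) (Code.word∈words (code φ ∣φ∣≤n))
      (code-of-description-singles-out q q-prime description (code φ ∣φ∣≤n))

  log-q≤8∣φ∣log∣φ∣ : ∀ φ → Describes (𝔽 q q-prime) φ → log q ≤ 8 * (∣ φ ∣ * log ∣ φ ∣)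
  log-q≤8∣φ∣log∣φ∣ φ describes = begin
    log q                    ≤⟨ log-q≤2+8na ⟩
    2 + 8 * (n * a)          ≤⟨ +-monoˡ-≤ (8 * (n * a)) (≤-trans (m≤m+n 2 6) (*-monoʳ-≤ 8 {1} {a} (s≤s z≤n))) ⟩
    8 * a + 8 * (n * a)      ≡⟨ *-distribˡ-+ 8 a (n * a) ⟨
    8 * (suc n * a)          ≤⟨ *-monoʳ-≤ 8 (*-mono-≤ n<∣φ∣ a≤log∣φ∣) ⟩
    8 * (∣ φ ∣ * log ∣ φ ∣)   ∎
    where
    open ≤-Reasoning
    n<∣φ∣ = describing-sentences-are-long φ describes
    a≤log∣φ∣ : a ≤ log ∣ φ ∣
    a≤log∣φ∣ = subst (_≤ log ∣ φ ∣) (⌈log₂2^n⌉≡n a) (⌈log₂⌉-mono-≤ (<⇒≤ n<∣φ∣))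

proposition4p3 : ∃[ k ] (1 ≤ k × ((N : ℕ) → ∃[ q ] (N ≤ q × Σ (Prime q) (λ pq → (φ : Formula) → Describes (𝔽 q pq) φ → log q ≤ k * (∣ φ ∣ * log ∣ φ ∣)))))
proposition4p3 = 8 , s≤s z≤n , λ N →
  let open PrimeWithoutShortDescription N in q , N≤q , q-prime , log-q≤8∣φ∣log∣φ∣
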